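{- Let $(S,\to,s^0)$ be a finite labeled transition system over a finite action set ${\sf Act}$ containing $\tau$, let $\langle A_?,A_>\rangle$ be a well-founded partition of ${\sf Act}$ for it with $\tau\in A_>$, let $\pi_0:S\to\mathbb{N}$ be arbitrary, let $h_1,h_2,\dots:\mathbb{N}\times{\sf Sig}\to\mathbb{N}$ be bijections, and let $\pi_i$ be the inductive branching partitions defined in the context. Write $s\mathrel{\underline{\leftrightarrow}}_i t$ iff $\pi_i(s)=\pi_i(t)$. Let $i\ge0$ and suppose $\mathrel{\underline{\leftrightarrow}}\subseteq\mathrel{\underline{\leftrightarrow}}_i$. Then for all states $s,t\in S$: if $s\mathrel{\underline{\leftrightarrow}} t$ and $t$ is canonical, then $s\mathrel{\underline{\leftrightarrow}}_{i+1}t$.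
   Context: A labeled transition system (LTS) is a triple $(S,\to,s^0)$ with $\to\subseteq S\times{\sf Act}\times S$; write $s\xrightarrow{a}t$ for $(s,a,t)\in\to$; $\xrightarrow{\tau}^*$ is the reflexive transitive closure of $\xrightarrow{\tau}$. A symmetric relation $R\subseteq S\times S$ is a branching bisimulation if whenever $s\,R\,t$ and $s\xrightarrow{a}s'$, either ($a=\tau$ and $s'\,R\,t$) or there are $t',t''$ with $t\xrightarrow{\tau}^*t'$, $s\,R\,t'$, $t'\xrightarrow{a}t''$, $s'\,R\,t''$. $s\mathrel{\underline{\leftrightarrow}}t$ (branching bisimilar) iff some branching bisimulation relates $s$ and $t$. A state $s$ is canonical if there is no $s'$ with $s\xrightarrow{\tau}s'$ and $s\mathrel{\underline{\leftrightarrow}}s'$. ${\sf Sig}$ is the set of finite subsets of ${\sf Act}\times\mathbb{N}$. A well-founded partition of ${\sf Act}$ for the LTS is a pair $\langle A_?,A_>\rangle$ with $A_?\cap A_>=\emptyset$, $A_?\cup A_>={\sf Act}$, such that there is no cycle of transitions labeled with actions in $A_>$; let $>$ be the transitive closure of $\bigcup_{a\in A_>}\xrightarrow{a}$. Given $\pi_i:S\to\mathbb{N}$, define $pre_{i+1}$, $sig_{i+1}$, $\pi_{i+1}$ simultaneously by well-founded recursion on $>$: $pre_{i+1}(s)=\{(a,\pi_i(t))\mid s\xrightarrow{a}t,\ a\in A_?\}\cup\{(a,\pi_{i+1}(t))\mid s\xrightarrow{a}t,\ a\in A_>\}$; $sig_{i+1}(s)=sig_{i+1}(t)$ for some $t$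 with $s\xrightarrow{\tau}t$, $\pi_i(s)=\pi_i(t)$ and $pre_{i+1}(s)\subseteq sig_{i+1}(t)\cup\{(\tau,\pi_{i+1}(t))\}$, if such a $t$ exists (all such $t$ give the same value); otherwise $sig_{i+1}(s)=pre_{i+1}(s)$; $\pi_{i+1}(s)=h_{i+1}(\pi_i(s),sig_{i+1}(s))$. -}

module Defs where

open import Data.Nat using (ℕ; suc)
open import Data.Fin using (Fin)
open import Data.Bool using (Bool; true; false)
open import Data.List using (List)
open import Data.List.Membership.Propositional using (_∈_)
open import Data.Product using (Σ; ∃; ∃₂; _×_; _,_)
open import Data.Sum using (_⊎_)
open import Relation.Nullary using (¬_)
open import Relation.Binary.PropositionalEquality using (_≡_)
open import Relation.Binary.Construct.Closure.ReflexiveTransitive using (Star)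
open import Relation.Binary.Construct.Closure.Transitive using (TransClosure)

Trans : ℕ → ℕ → Set
Trans n m = Fin n → Fin m → Fin n → Bool

Step : ∀ {n m} → Trans n m → Fin n → Fin m → Fin n → Set
Step T s a t = T s a t ≡ true

TauStar : ∀ {n m} → Trans n m → Fin m → Fin n → Fin n → Set
TauStar T τ = Star (λ x y → Step T x τ y)

IsBranchingBisim : ∀ {n m} → Trans n m → Fin m → (Fin n → Fin n → Set) → Set
IsBranchingBisim {n} {m} T τ R =
  (∀ s t → R s t → R t s) ×
  (∀ s t (a : Fin m) s' → R s t → Step T s a s' →
     (a ≡ τ × R s' t) ⊎
     ∃₂ λ t' t'' → TauStar T τ t t' × R s t' × Step T t' a t'' × R s' t'')

Bisim : ∀ {n m} → Trans n m → Fin m → Fin n → Fin n → Set₁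
Bisim {n} T τ s t = Σ (Fin n → Fin n → Set) λ R → IsBranchingBisim T τ R × R s t

Canonical : ∀ {n m} → Trans n m → Fin m → Fin n → Set₁
Canonical T τ s = ¬ (∃ λ s' → Step T s τ s' × Bisim T τ s s')

-- Sig: finite subsets of Act × ℕ, represented by lists up to set equality
Sig : ℕ → Set
Sig m = List (Fin m × ℕ)

_≈ˢ_ : ∀ {m} → Sig m → Sig m → Set
X ≈ˢ Y = ∀ x → (x ∈ X → x ∈ Y) × (x ∈ Y → x ∈ X)

-- ⟨A?,A>⟩ given by the characteristic function Agt of A> (A? = complement).
-- Well-founded: no cycle of transitions labelled with actions in A>.
WellFoundedPartition : ∀ {n m} → Trans n m → (Fin m → Bool) → Set
WellFoundedPartition {n} T Agt =
  ∀ (s : Fin n) → ¬ TransClosure (λ x y → ∃ λ a → Agt a ≡ true × Step T x a y) s s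

-- h : ℕ × Sig → ℕ is a bijection (Sig taken up to set equality)
IsSigBijection : ∀ {m} → (ℕ × Sig m → ℕ) → Set
IsSigBijection {m} h =
  (∀ k X Y → X ≈ˢ Y → h (k , X) ≡ h (k , Y)) ×
  (∀ k l X Y → h (k , X) ≡ h (l , Y) → k ≡ l × X ≈ˢ Y) ×
  (∀ (j : ℕ) → ∃ λ (p : ℕ × Sig m) → h p ≡ j)

InPre : ∀ {n m} → Trans n m → (Fin m → Bool) → (ℕ → Fin n → ℕ) →
        ℕ → Fin n → Fin m × ℕ → Set
InPre T Agt π i s (a , k) =
  ∃ λ t → Step T s a t ×
    ((Agt a ≡ false × k ≡ π i t) ⊎ (Agt a ≡ true × k ≡ π (suc i) t))

SigCand : ∀ {n m} → Trans n m → Fin m → (Fin m → Bool) → (ℕ → Fin n → ℕ) →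
          (ℕ → Fin n → Sig m) → ℕ → Fin n → Fin n → Set
SigCand T τ Agt π sig i s t =
  Step T s τ t × π i s ≡ π i t ×
  (∀ x → InPre T Agt π i s x → x ∈ sig (suc i) t ⊎ x ≡ (τ , π (suc i) t))

IsInductiveBranchingPartition : ∀ {n m} → Trans n m → Fin m → (Fin m → Bool) →
  (ℕ → ℕ × Sig m → ℕ) → (ℕ → Fin n → ℕ) → (ℕ → Fin n → Sig m) → Set
IsInductiveBranchingPartition T τ Agt h π sig =
  (∀ i s →
     (∃ λ t → SigCand T τ Agt π sig i s t × sig (suc i) s ≈ˢ sig (suc i) t) ⊎
     ((¬ ∃ λ t → SigCand T τ Agt π sig i s t) ×
      (∀ x → (x ∈ sig (suc i) s → InPre T Agt π i s x) ×
             (InPre T Agt π i s x → x ∈ sig (suc i) s)))) ×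
  (∀ i s → π (suc i) s ≡ h (suc i) (π i s , sig (suc i) s))

-- Heights along A>-transitions are well defined because such transitions have no cycles,
-- and τ-steps lower them since τ ∈ A>. For bisimilar u, v we show π_{i+1}(u) = π_{i+1}(v)
-- by induction on the larger height and then on the sum of heights. If the classes differed,
-- every entry of pre_{i+1}(u) would be one of pre_{i+1}(v): a τ-step of u answered by v
-- standing still, or an answer of v starting with a τ-step, is an inert step between
-- bisimilar states of smaller measure and so preserves π_{i+1}, contradicting the
-- assumption; any other answer leads to lower A>-targets, which agree by induction, or to
-- A?-targets, which agree by ↔ ⊆ ↔_i. But equal π_i and equal pre_{i+1} force equal
-- π_{i+1}: two τ-candidates in the signature definition lie in the same class, since
-- otherwise each class would contain a τ-entry for the other and yield an infinite descent.

module Submission where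

open import Defs
open import Data.Bool using (Bool; true; false)
import Data.Bool as Bool
open import Data.Empty using (⊥; ⊥-elim)
open import Data.Fin using (Fin)
open import Data.Fin.Induction using (spo-noetherian)
open import Data.Fin.Properties using (any?)
open import Data.List using (map; allFin)
open import Data.List.Extrema.Nat using (max; xs≤max)
open import Data.List.Membership.Propositional using (_∈_)
open import Data.List.Membership.Propositional.Properties using (∈-map⁺; ∈-allFin)
open import Data.List.Properties using (map-cong)
import Data.List.Relation.Unary.All as All
open import Data.Nat using (ℕ; suc; _+_; _≤_; _<_; s≤s; _≟_)
open import Data.Nat.Induction using (<-wellFounded)
open import Data.Nat.Properties
  using ( ≤-refl; ≤-trans; ≤-reflexive; <-trans; <⇒≤; <-≤-trans; ≤-<-trans
        ; +-comm; +-monoˡ-<; +-monoʳ-<; m≤m+n; m≤n+m )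
open import Data.Product using (∃; ∃₂; _×_; _,_; proj₁; proj₂)
open import Data.Sum using (_⊎_; inj₁; inj₂)
open import Function using (flip; _∘_)
open import Induction.WellFounded using (Acc; acc; WellFounded; module Subrelation)
open import Level using (0ℓ)
open import Relation.Binary using (Rel; Decidable; Symmetric; IsStrictPartialOrder)
open import Relation.Binary.Construct.Closure.ReflexiveTransitive using (Star; ε; _◅_; _◅◅_; reverse)
open import Relation.Binary.Construct.Closure.Transitive using (TransClosure; [_]; transitive)
open import Relation.Binary.PropositionalEquality
  using (_≡_; _≢_; refl; sym; trans; cong; isEquivalence; resp₂; module ≡-Reasoning)
open import Relation.Nullary using (¬_; Dec; yes; no; contradiction)
open import Relation.Nullary.Decidable using (_×-dec_)
open import Relation.Unary using (Pred; _⊆_; _≐_)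

open ≡-Reasoning

module Acyclic {n : ℕ} {_⇝_ : Rel (Fin n) 0ℓ} (_⇝?_ : Decidable _⇝_)
               (acyclic : ∀ x → ¬ TransClosure _⇝_ x x) where

  wellFounded : WellFounded (flip _⇝_)
  wellFounded = Subrelation.wellFounded [_] (spo-noetherian ⇝⁺-isStrictPartialOrder)
    where
    ⇝⁺-isStrictPartialOrder : IsStrictPartialOrder _≡_ (TransClosure _⇝_)
    ⇝⁺-isStrictPartialOrder = record
      { isEquivalence = isEquivalence
      ; irrefl        = λ { refl → acyclic _ }
      ; trans         = transitive _⇝_
      ; <-resp-≈      = resp₂ (TransClosure _⇝_)
      }

  private
    edgeHeight : ∀ {x y} → Dec (x ⇝ y) → (x ⇝ y → ℕ) → ℕ
    edgeHeight (yes x⇝y) f = suc (f x⇝y)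
    edgeHeight (no _)    _ = 0

    heightAcc : ∀ x → Acc (flip _⇝_) x → ℕ
    heightAcc x (acc rs) =
      max 0 (map (λ y → edgeHeight (x ⇝? y) (λ x⇝y → heightAcc y (rs x⇝y))) (allFin n))

    heightAcc-irrelevant : ∀ x (a b : Acc (flip _⇝_) x) → heightAcc x a ≡ heightAcc x b
    heightAcc-irrelevant x (acc rs) (acc rs′) =
      cong (max 0) (map-cong (λ y → edgeHeight-cong (x ⇝? y)) (allFin n))
      where
      edgeHeight-cong : ∀ {y} (d : Dec (x ⇝ y)) →
        edgeHeight d (λ x⇝y → heightAcc y (rs x⇝y)) ≡ edgeHeight d (λ x⇝y → heightAcc y (rs′ x⇝y))
      edgeHeight-cong (yes x⇝y) = cong suc (heightAcc-irrelevant _ (rs x⇝y) (rs′ x⇝y))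
      edgeHeight-cong (no _)    = refl

    suc≤edgeHeight : ∀ {x y k} (d : Dec (x ⇝ y)) (f : x ⇝ y → ℕ) →
                     (∀ x⇝y → f x⇝y ≡ k) → x ⇝ y → suc k ≤ edgeHeight d f
    suc≤edgeHeight (yes x⇝y) f f≡k _   = s≤s (≤-reflexive (sym (f≡k x⇝y)))
    suc≤edgeHeight (no ¬x⇝y) _ _   x⇝y = contradiction x⇝y ¬x⇝y

  height : Fin n → ℕ
  height x = heightAcc x (wellFounded x)

  height-< : ∀ {x y} → x ⇝ y → height y < height x
  height-< {x} {y} x⇝y with wellFounded x
  ... | acc rs = ≤-trans
    (suc≤edgeHeight (x ⇝? y) _ (λ x⇝y′ → heightAcc-irrelevant y (rs x⇝y′) (wellFounded y)) x⇝y)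
    (All.lookup (xs≤max 0 _) (∈-map⁺ _ (∈-allFin y)))

module BranchingBisimulation {n m : ℕ} (T : Trans n m) (τ : Fin m)
                             (R : Rel (Fin n) 0ℓ) (R-bisim : IsBranchingBisim T τ R) where

  infix 4 _~_ _⇒_
  _~_ _⇒_ : Rel (Fin n) 0ℓ
  _~_ = Star R
  _⇒_ = TauStar T τ

  ~-sym : Symmetric _~_
  ~-sym = reverse (λ {x} {y} → proj₁ R-bisim x y)

  R-⇒-transfer : ∀ {s t s′} → R s t → s ⇒ s′ → ∃ λ t′ → t ⇒ t′ × R s′ t′
  R-⇒-transfer r ε = _ , ε , r
  R-⇒-transfer r (s⟶ ◅ s⇒) with proj₂ R-bisim _ _ τ _ r s⟶
  ... | inj₁ (_ , r′) = R-⇒-transfer r′ s⇒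
  ... | inj₂ (_ , _ , t⇒ , _ , t⟶ , r′) with R-⇒-transfer r′ s⇒
  ...   | t′ , t⇒′ , r″ = t′ , t⇒ ◅◅ (t⟶ ◅ t⇒′) , r″

  ~-⇒-transfer : ∀ {s t s′} → s ~ t → s ⇒ s′ → ∃ λ t′ → t ⇒ t′ × s′ ~ t′
  ~-⇒-transfer ε s⇒ = _ , s⇒ , ε
  ~-⇒-transfer (r ◅ s~t) s⇒ with R-⇒-transfer r s⇒
  ... | _ , u⇒ , r′ with ~-⇒-transfer s~t u⇒
  ...   | t′ , t⇒ , u~t = t′ , t⇒ , r′ ◅ u~t

  Matched : Fin n → Fin m → Fin n → Fin n → Set
  Matched y a y′ t =
    (a ≡ τ × ∃ λ z → t ⇒ z × y ~ z × y′ ~ z) ⊎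
    (∃₂ λ z z′ → t ⇒ z × y ~ z × Step T z a z′ × y′ ~ z′)

  ~-matched : ∀ {x t y a y′} → x ~ t → x ⇒ y → Step T y a y′ → Matched y a y′ t
  ~-matched ε x⇒y y⟶ = inj₂ (_ , _ , x⇒y , ε , y⟶ , ε)
  ~-matched {a = a} (r ◅ u~t) x⇒y y⟶ with R-⇒-transfer r x⇒y
  ... | v , u⇒v , r′ with proj₂ R-bisim _ _ a _ r′ y⟶
  ...   | inj₁ (a≡τ , r″) with ~-⇒-transfer u~t u⇒v
  ...     | z , t⇒z , v~z = inj₁ (a≡τ , z , t⇒z , r′ ◅ v~z , r″ ◅ v~z)
  ~-matched (r ◅ u~t) x⇒y y⟶ | v , u⇒v , r′ | inj₂ (w , w′ , v⇒w , rw , w⟶ , rw′)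
    with ~-matched u~t (u⇒v ◅◅ v⇒w) w⟶
  ... | inj₁ (a≡τ , z , t⇒z , w~z , w′~z) = inj₁ (a≡τ , z , t⇒z , rw ◅ w~z , rw′ ◅ w′~z)
  ... | inj₂ (z , z′ , t⇒z , w~z , z⟶ , w′~z′) = inj₂ (z , z′ , t⇒z , rw ◅ w~z , z⟶ , rw′ ◅ w′~z′)

  ~-branching : ∀ s t a s′ → s ~ t → Step T s a s′ →
                (a ≡ τ × s′ ~ t) ⊎ ∃₂ λ t′ t″ → t ⇒ t′ × s ~ t′ × Step T t′ a t″ × s′ ~ t″
  ~-branching s t a s′ s~t s⟶ with ~-matched s~t ε s⟶
  ... | inj₁ (a≡τ , _ , _ , s~z , s′~z) = inj₁ (a≡τ , s′~z ◅◅ ~-sym s~z ◅◅ s~t)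
  ... | inj₂ match = inj₂ match

  ~-isBranchingBisim : IsBranchingBisim T τ _~_
  ~-isBranchingBisim = (λ _ _ → ~-sym) , ~-branching

  ~-stuttering : ∀ {x y u} → Acc (λ y x → Step T x τ y) x → x ~ y → x ⇒ u → u ⇒ y → u ~ x
  ~-stuttering _ _ ε _ = ε
  ~-stuttering {x} (acc rs) x~y (x⟶ ◅ x₁⇒u) u⇒y =
    ~-stuttering (rs x⟶) (x₁~x ◅◅ x~y) x₁⇒u u⇒y ◅◅ x₁~x
    where
    x₁~x : _ ~ x
    x₁~x with ~-matched x~y ε x⟶
    ... | inj₁ (_ , _ , _ , x~z , x₁~z) = x₁~z ◅◅ ~-sym x~z
    ... | inj₂ (_ , _ , y⇒z , x~z , z⟶ , x₁~z′) =
          ~-sym (~-stuttering (rs x⟶) x₁~z′ (x₁⇒u ◅◅ u⇒y ◅◅ y⇒z) (z⟶ ◅ ε)) ◅◅ ~-sym x~z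

module InductiveBranchingPartition
    {n m : ℕ} (T : Trans n m) (τ : Fin m) (Agt : Fin m → Bool)
    (wfp : WellFoundedPartition T Agt) (τ∈A> : Agt τ ≡ true)
    (h : ℕ → ℕ × Sig m → ℕ) (h-bijective : ∀ j → IsSigBijection (h (suc j)))
    (π : ℕ → Fin n → ℕ) (sig : ℕ → Fin n → Sig m)
    (ibp : IsInductiveBranchingPartition T τ Agt h π sig) (i : ℕ) where

  _⟶>_ : Rel (Fin n) 0ℓ
  x ⟶> y = ∃ λ a → Agt a ≡ true × Step T x a y

  _⟶>?_ : Decidable _⟶>_
  x ⟶>? y = any? (λ a → (Agt a Bool.≟ true) ×-dec (T x a y Bool.≟ true))

  open Acyclic _⟶>?_ wfp

  τ-step : ∀ {x y} → Step T x τ y → x ⟶> y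
  τ-step x⟶y = τ , τ∈A> , x⟶y

  τ∉A? : Agt τ ≡ false → ⊥
  τ∉A? τ∈A? with trans (sym τ∈A>) τ∈A?
  ... | ()

  height-⇒ : ∀ {x y} → TauStar T τ x y → height y ≤ height x
  height-⇒ ε = ≤-refl
  height-⇒ (x⟶ ◅ x₁⇒y) = ≤-trans (height-⇒ x₁⇒y) (<⇒≤ (height-< (τ-step x⟶)))

  πᵢ πᵢ₊₁ : Fin n → ℕ
  πᵢ   = π i
  πᵢ₊₁ = π (suc i)

  sigᵢ₊₁ : Fin n → Sig m
  sigᵢ₊₁ = sig (suc i)

  Pre : Fin n → Pred (Fin m × ℕ) 0ℓ
  Pre = InPre T Agt π i

  PreLabel : Fin m → ℕ → Fin n → Set
  PreLabel a k t = (Agt a ≡ false × k ≡ πᵢ t) ⊎ (Agt a ≡ true × k ≡ πᵢ₊₁ t)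

  sig⁺ : Fin n → Pred (Fin m × ℕ) 0ℓ
  sig⁺ t x = x ∈ sigᵢ₊₁ t ⊎ x ≡ (τ , πᵢ₊₁ t)

  IsCandidate : Fin n → Fin n → Set
  IsCandidate = SigCand T τ Agt π sig i

  sig-def : ∀ s →
    (∃ λ t → IsCandidate s t × sigᵢ₊₁ s ≈ˢ sigᵢ₊₁ t) ⊎
    ((¬ ∃ (IsCandidate s)) × (∀ x → (x ∈ sigᵢ₊₁ s → Pre s x) × (Pre s x → x ∈ sigᵢ₊₁ s)))
  sig-def = proj₁ ibp i

  πᵢ₊₁-def : ∀ s → πᵢ₊₁ s ≡ h (suc i) (πᵢ s , sigᵢ₊₁ s)
  πᵢ₊₁-def = proj₂ ibp i

  πᵢ₊₁-injective : ∀ {x y} → πᵢ₊₁ x ≡ πᵢ₊₁ y → πᵢ x ≡ πᵢ y × sigᵢ₊₁ x ≈ˢ sigᵢ₊₁ y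
  πᵢ₊₁-injective {x} {y} eq = proj₁ (proj₂ (h-bijective i)) _ _ _ _ (begin
    h (suc i) (πᵢ x , sigᵢ₊₁ x) ≡⟨ sym (πᵢ₊₁-def x) ⟩
    πᵢ₊₁ x                      ≡⟨ eq ⟩
    πᵢ₊₁ y                      ≡⟨ πᵢ₊₁-def y ⟩
    h (suc i) (πᵢ y , sigᵢ₊₁ y) ∎)

  πᵢ₊₁-cong : ∀ {x y} → πᵢ x ≡ πᵢ y → sigᵢ₊₁ x ≈ˢ sigᵢ₊₁ y → πᵢ₊₁ x ≡ πᵢ₊₁ y
  πᵢ₊₁-cong {x} {y} πᵢ-eq sig-eq = begin
    πᵢ₊₁ x                      ≡⟨ πᵢ₊₁-def x ⟩
    h (suc i) (πᵢ x , sigᵢ₊₁ x) ≡⟨ cong (λ k → h (suc i) (k , sigᵢ₊₁ x)) πᵢ-eq ⟩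
    h (suc i) (πᵢ y , sigᵢ₊₁ x) ≡⟨ proj₁ (h-bijective i) _ _ _ sig-eq ⟩
    h (suc i) (πᵢ y , sigᵢ₊₁ y) ≡⟨ sym (πᵢ₊₁-def y) ⟩
    πᵢ₊₁ y                      ∎

  sigᵢ₊₁-cong : ∀ {x y e} → πᵢ₊₁ x ≡ πᵢ₊₁ y → e ∈ sigᵢ₊₁ x → e ∈ sigᵢ₊₁ y
  sigᵢ₊₁-cong eq = proj₁ (proj₂ (πᵢ₊₁-injective eq) _)

  sig⁺-cong : ∀ {x y} → πᵢ₊₁ x ≡ πᵢ₊₁ y → sig⁺ x ⊆ sig⁺ y
  sig⁺-cong eq (inj₁ e∈) = inj₁ (sigᵢ₊₁-cong eq e∈)
  sig⁺-cong eq (inj₂ e≡) = inj₂ (trans e≡ (cong (τ ,_) eq))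

  τ-successor∈pre : ∀ {s t} → Step T s τ t → Pre s (τ , πᵢ₊₁ t)
  τ-successor∈pre s⟶t = _ , s⟶t , inj₂ (τ∈A> , refl)

  τ∈sig-descends : ∀ {s k} → Acc (flip _⟶>_) s → (τ , k) ∈ sigᵢ₊₁ s →
                   ∃ λ w → πᵢ₊₁ w ≡ k × height w < height s
  τ∈sig-descends {s} (acc rs) k∈ with sig-def s
  ... | inj₁ (t , (s⟶t , _) , sig≈) with τ∈sig-descends (rs (τ-step s⟶t)) (proj₁ (sig≈ _) k∈)
  ...   | w , w≡k , w<t = w , w≡k , <-trans w<t (height-< (τ-step s⟶t))
  τ∈sig-descends (acc rs) k∈ | inj₂ (_ , sig≐pre) with proj₁ (sig≐pre _) k∈
  ... | t , s⟶t , inj₁ (τ∈A? , _) = ⊥-elim (τ∉A? τ∈A?)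
  ... | t , s⟶t , inj₂ (_ , k≡t) = t , sym k≡t , height-< (τ-step s⟶t)

  -- Every state of either class would have a strictly lower state in the other class.
  τ-entries-not-mutual : ∀ {u v} → (τ , πᵢ₊₁ v) ∈ sigᵢ₊₁ u → (τ , πᵢ₊₁ u) ∈ sigᵢ₊₁ v → ⊥
  τ-entries-not-mutual {u} {v} v∈u u∈v = descent _ (<-wellFounded _) (inj₁ refl)
    where
    descent : ∀ x → Acc _<_ (height x) → πᵢ₊₁ x ≡ πᵢ₊₁ u ⊎ πᵢ₊₁ x ≡ πᵢ₊₁ v → ⊥
    descent x (acc rs) (inj₁ x≡u) with τ∈sig-descends (wellFounded x) (sigᵢ₊₁-cong (sym x≡u) v∈u)
    ... | w , w≡v , w<x = descent w (rs w<x) (inj₂ w≡v)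
    descent x (acc rs) (inj₂ x≡v) with τ∈sig-descends (wellFounded x) (sigᵢ₊₁-cong (sym x≡v) u∈v)
    ... | w , w≡u , w<x = descent w (rs w<x) (inj₁ w≡u)

  candidates-agree : ∀ {s t₁ t₂} → IsCandidate s t₁ → IsCandidate s t₂ → πᵢ₊₁ t₁ ≡ πᵢ₊₁ t₂
  candidates-agree (s⟶t₁ , _ , pre⊆₁) (s⟶t₂ , _ , pre⊆₂)
    with pre⊆₁ _ (τ-successor∈pre s⟶t₂) | pre⊆₂ _ (τ-successor∈pre s⟶t₁)
  ... | inj₂ t₂≡t₁ | _           = sym (cong proj₂ t₂≡t₁)
  ... | inj₁ _     | inj₂ t₁≡t₂ = cong proj₂ t₁≡t₂
  ... | inj₁ t₂∈   | inj₁ t₁∈   = ⊥-elim (τ-entries-not-mutual t₂∈ t₁∈)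

  candidate-agrees : ∀ {s t} → IsCandidate s t → πᵢ₊₁ s ≡ πᵢ₊₁ t
  candidate-agrees {s} s▷t with sig-def s
  ... | inj₁ (t₀ , s▷t₀@(_ , πᵢ-eq , _) , sig≈) =
        trans (πᵢ₊₁-cong πᵢ-eq sig≈) (candidates-agree s▷t₀ s▷t)
  ... | inj₂ (no-candidate , _) = ⊥-elim (no-candidate (_ , s▷t))

  pre⊆sig⁺ : ∀ {s} → Pre s ⊆ sig⁺ s
  pre⊆sig⁺ {s} e∈pre with sig-def s
  ... | inj₁ (t₀ , s▷t₀@(_ , _ , pre⊆) , _) = sig⁺-cong (sym (candidate-agrees s▷t₀)) (pre⊆ _ e∈pre)
  ... | inj₂ (_ , sig≐pre) = inj₁ (proj₂ (sig≐pre _) e∈pre)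

  candidate-transfer : ∀ {u v t} → IsCandidate u t → πᵢ u ≡ πᵢ v → Pre u ≐ Pre v →
                       ∃ λ t′ → IsCandidate v t′ × πᵢ₊₁ t ≡ πᵢ₊₁ t′
  candidate-transfer {u} {v} (u⟶t , πᵢ-ut , pre⊆) πᵢ-uv (u⊆v , v⊆u) with u⊆v (τ-successor∈pre u⟶t)
  ... | _  , _    , inj₁ (τ∈A? , _) = ⊥-elim (τ∉A? τ∈A?)
  ... | t′ , v⟶t′ , inj₂ (_ , t≡t′) =
        t′ , (v⟶t′ , πᵢ-vt′ , λ _ e∈ → sig⁺-cong t≡t′ (pre⊆ _ (v⊆u e∈))) , t≡t′
    where
    πᵢ-vt′ : πᵢ v ≡ πᵢ t′
    πᵢ-vt′ = trans (sym πᵢ-uv) (trans πᵢ-ut (proj₁ (πᵢ₊₁-injective t≡t′)))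

  πᵢ₊₁-pre-cong : ∀ {u v} → πᵢ u ≡ πᵢ v → Pre u ≐ Pre v → πᵢ₊₁ u ≡ πᵢ₊₁ v
  πᵢ₊₁-pre-cong {u} {v} πᵢ-uv pre-uv with sig-def u | sig-def v
  ... | inj₁ (t , u▷t , _) | _ with candidate-transfer u▷t πᵢ-uv pre-uv
  ...   | t′ , v▷t′ , t≡t′ = trans (candidate-agrees u▷t) (trans t≡t′ (sym (candidate-agrees v▷t′)))
  πᵢ₊₁-pre-cong πᵢ-uv (u⊆v , v⊆u) | inj₂ _ | inj₁ (t , v▷t , _)
    with candidate-transfer v▷t (sym πᵢ-uv) (v⊆u , u⊆v)
  ... | t′ , u▷t′ , t≡t′ = trans (candidate-agrees u▷t′) (trans (sym t≡t′) (sym (candidate-agrees v▷t)))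
  πᵢ₊₁-pre-cong πᵢ-uv (u⊆v , v⊆u) | inj₂ (_ , sig≐preᵤ) | inj₂ (_ , sig≐preᵥ) =
    πᵢ₊₁-cong πᵢ-uv λ e →
      (λ e∈ → proj₂ (sig≐preᵥ e) (u⊆v (proj₁ (sig≐preᵤ e) e∈))) ,
      (λ e∈ → proj₂ (sig≐preᵤ e) (v⊆u (proj₁ (sig≐preᵥ e) e∈)))

  τ-wellFounded : WellFounded (λ y x → Step T x τ y)
  τ-wellFounded = Subrelation.wellFounded τ-step wellFounded

  module Bisimilar (R : Rel (Fin n) 0ℓ) (R-bisim : IsBranchingBisim T τ R)
                   (bisim⇒πᵢ : ∀ s t → Bisim T τ s t → πᵢ s ≡ πᵢ t) where

    open BranchingBisimulation T τ R R-bisim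

    ~⇒πᵢ : ∀ {x y} → x ~ y → πᵢ x ≡ πᵢ y
    ~⇒πᵢ x~y = bisim⇒πᵢ _ _ (_~_ , ~-isBranchingBisim , x~y)

    AgreeBelow : ℕ → Set
    AgreeBelow N = ∀ {u v} → height u < N → height v < N → u ~ v → πᵢ₊₁ u ≡ πᵢ₊₁ v

    AgreeWithin : ℕ → ℕ → Set
    AgreeWithin N M = ∀ {u v} → height u + height v < M → height u ≤ N → height v ≤ N →
                      u ~ v → πᵢ₊₁ u ≡ πᵢ₊₁ v

    preLabel-transfer : ∀ {N a k x y} → AgreeBelow N → (Agt a ≡ true → height x < N × height y < N) →
                        x ~ y → PreLabel a k x → PreLabel a k y
    preLabel-transfer _  _ x~y (inj₁ (a∈A? , k≡x)) = inj₁ (a∈A? , trans k≡x (~⇒πᵢ x~y))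
    preLabel-transfer agree bounded x~y (inj₂ (a∈A> , k≡x)) =
      inj₂ (a∈A> , trans k≡x (agree (proj₁ (bounded a∈A>)) (proj₂ (bounded a∈A>)) x~y))

    inert-τ-step : ∀ {N x y} → AgreeBelow N → height x ≤ N → Step T x τ y → x ~ y → πᵢ₊₁ x ≡ πᵢ₊₁ y
    inert-τ-step {N} {x} {y} agree x≤N x⟶y x~y = candidate-agrees (x⟶y , ~⇒πᵢ x~y , pre⊆sig⁺-y)
      where
      y<N : height y < N
      y<N = <-≤-trans (height-< (τ-step x⟶y)) x≤N

      pre⊆sig⁺-y : ∀ e → Pre x e → sig⁺ y e
      pre⊆sig⁺-y (a , k) (x′ , x⟶x′ , label) with ~-branching x y a x′ x~y x⟶x′
      ... | inj₁ (refl , x′~y) with label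
      ...   | inj₁ (τ∈A? , _) = ⊥-elim (τ∉A? τ∈A?)
      ...   | inj₂ (_ , k≡x′) =
              inj₂ (cong (τ ,_) (trans k≡x′ (agree (<-≤-trans (height-< (τ-step x⟶x′)) x≤N) y<N x′~y)))
      pre⊆sig⁺-y (a , k) (x′ , x⟶x′ , label) | inj₂ (w , w′ , y⇒w , x~w , w⟶w′ , x′~w′) =
        sig⁺-cong w≡y (pre⊆sig⁺ (w′ , w⟶w′ , preLabel-transfer agree bounded x′~w′ label))
        where
        w<N : height w < N
        w<N = ≤-<-trans (height-⇒ y⇒w) y<N
        w≡y : πᵢ₊₁ w ≡ πᵢ₊₁ y
        w≡y = agree w<N y<N (~-sym x~w ◅◅ x~y)
        bounded : Agt a ≡ true → height x′ < N × height w′ < N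
        bounded a∈A> = <-≤-trans (height-< (a , a∈A> , x⟶x′)) x≤N ,
                       <-trans (height-< (a , a∈A> , w⟶w′)) w<N

    pre-⊆ : ∀ {N M u v} → AgreeBelow N → AgreeWithin N M →
            height u + height v ≤ M → height u ≤ N → height v ≤ N → u ~ v →
            πᵢ₊₁ u ≢ πᵢ₊₁ v → Pre u ⊆ Pre v
    pre-⊆ {N} {u = u} {v} agree agree-within u+v≤M u≤N v≤N u~v u≢v {a , k} (u′ , u⟶u′ , label)
      with ~-branching u v a u′ u~v u⟶u′
    ... | inj₁ (refl , u′~v) = contradiction (trans u≡u′ u′≡v) u≢v
      where
      u′<u : height u′ < height u
      u′<u = height-< (τ-step u⟶u′)
      u≡u′ : πᵢ₊₁ u ≡ πᵢ₊₁ u′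
      u≡u′ = inert-τ-step agree u≤N u⟶u′ (u~v ◅◅ ~-sym u′~v)
      u′≡v : πᵢ₊₁ u′ ≡ πᵢ₊₁ v
      u′≡v = agree-within (<-≤-trans (+-monoˡ-< (height v) u′<u) u+v≤M) (<⇒≤ (<-≤-trans u′<u u≤N)) v≤N
                          u′~v
    ... | inj₂ (_ , v′ , ε , _ , v⟶v′ , u′~v′) = v′ , v⟶v′ , preLabel-transfer agree bounded u′~v′ label
      where
      bounded : Agt a ≡ true → height u′ < N × height v′ < N
      bounded a∈A> = <-≤-trans (height-< (a , a∈A> , u⟶u′)) u≤N ,
                     <-≤-trans (height-< (a , a∈A> , v⟶v′)) v≤N
    ... | inj₂ (w , _ , _◅_ {j = v₁} v⟶v₁ v₁⇒w , u~w , _ , _) = contradiction (trans u≡v₁ (sym v≡v₁)) u≢v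
      where
      v₁<v : height v₁ < height v
      v₁<v = height-< (τ-step v⟶v₁)
      v₁~v : v₁ ~ v
      v₁~v = ~-stuttering (τ-wellFounded v) (~-sym u~v ◅◅ u~w) (v⟶v₁ ◅ ε) v₁⇒w
      u≡v₁ : πᵢ₊₁ u ≡ πᵢ₊₁ v₁
      u≡v₁ = agree-within (<-≤-trans (+-monoʳ-< (height u) v₁<v) u+v≤M) u≤N (<⇒≤ (<-≤-trans v₁<v v≤N))
                          (u~v ◅◅ ~-sym v₁~v)
      v≡v₁ : πᵢ₊₁ v ≡ πᵢ₊₁ v₁
      v≡v₁ = inert-τ-step agree v≤N v⟶v₁ (~-sym v₁~v)

    agree-step : ∀ {N M u v} → AgreeBelow N → AgreeWithin N M →
                 height u + height v ≤ M → height u ≤ N → height v ≤ N → u ~ v → πᵢ₊₁ u ≡ πᵢ₊₁ v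
    agree-step {u = u} {v} agree agree-within u+v≤M u≤N v≤N u~v with πᵢ₊₁ u ≟ πᵢ₊₁ v
    ... | yes u≡v = u≡v
    ... | no u≢v = contradiction (πᵢ₊₁-pre-cong (~⇒πᵢ u~v) (u⊆v , v⊆u)) u≢v
      where
      u⊆v : Pre u ⊆ Pre v
      u⊆v = pre-⊆ agree agree-within u+v≤M u≤N v≤N u~v u≢v
      v⊆u : Pre v ⊆ Pre u
      v⊆u = pre-⊆ agree agree-within (≤-trans (≤-reflexive (+-comm (height v) (height u))) u+v≤M)
                  v≤N u≤N (~-sym u~v) (u≢v ∘ sym)

    agree-within : ∀ {N} → AgreeBelow N → ∀ M → AgreeWithin N M
    agree-within agree (suc M) (s≤s u+v≤M) = agree-step agree (agree-within agree M) u+v≤M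

    agree-below : ∀ N → AgreeBelow N
    agree-below (suc N) {u} {v} (s≤s u≤N) (s≤s v≤N) =
      agree-within (agree-below N) (suc (height u + height v)) ≤-refl u≤N v≤N

    ~⇒πᵢ₊₁ : ∀ {u v} → u ~ v → πᵢ₊₁ u ≡ πᵢ₊₁ v
    ~⇒πᵢ₊₁ {u} {v} = agree-below (suc (height u + height v)) (s≤s (m≤m+n _ _)) (s≤s (m≤n+m _ _))

lemma1 : ∀ {n m} (T : Trans n m) (s⁰ : Fin n) (τ : Fin m) (Agt : Fin m → Bool) →
    WellFoundedPartition T Agt → Agt τ ≡ true →
    (h : ℕ → ℕ × Sig m → ℕ) → (∀ j → IsSigBijection (h (suc j))) →
    (π : ℕ → Fin n → ℕ) (sig : ℕ → Fin n → Sig m) →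
    IsInductiveBranchingPartition T τ Agt h π sig →
    (i : ℕ) → (∀ s t → Bisim T τ s t → π i s ≡ π i t) →
    ∀ s t → Bisim T τ s t → Canonical T τ t → π (suc i) s ≡ π (suc i) t
lemma1 T _ τ Agt wfp τ∈A> h h-bijective π sig ibp i bisim⇒πᵢ s t (R , R-bisim , sRt) _ =
  Bisimilar.~⇒πᵢ₊₁ R R-bisim bisim⇒πᵢ (sRt ◅ ε)
  where open InductiveBranchingPartition T τ Agt wfp τ∈A> h h-bijective π sig ibp i
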